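{- There exist a set $X$, a numbered subbasis $(\mathfrak{B},\beta)$ for $X$ and a subset $A\subseteq X$ such that, for the restricted numbered subbasis $(\mathfrak{A},\alpha)$ of $A$, the embedding $A\hookrightarrow X$ is not $(\rho_{\alpha}^{\min},\rho_{\beta}^{\min})$-computable.
   Context: A multi-representation of a set $Y$ is a partial multi-valued map $\rho:\subseteq\mathbb{N}^{\mathbb{N}}\rightrightarrows Y$ (an assignment $f\mapsto\rho(f)\subseteq Y$, $\text{dom}(\rho)=\{f:\rho(f)\neq\emptyset\}$) with every point in some $\rho(f)$. A map $h:Y_1\to Y_2$ is $(\rho_1,\rho_2)$-computable if there is a Type-2 computable partial $F:\subseteq\mathbb{N}^{\mathbb{N}}\to\mathbb{N}^{\mathbb{N}}$ defined on all $f\in\text{dom}(\rho_1)$ such that $x\in\rho_1(f)$ implies $h(x)\in\rho_2(F(f))$. A numbered subbasis for $X$ is a countable $\mathfrak{B}\subseteq\mathcal{P}(X)$ with a partial surjection $\beta:\subseteq\mathbb{N}\to\mathfrak{B}$. The multi-representation $\rho_\beta^{\min}$ of $X$: $x\in\rho_\beta^{\min}(f)$ iff every $f(n)\in\text{dom}(\beta)$ with $x\in\beta(f(n))$, and for every $B\in\mathfrak{B}$ with $x\in B$ there exist $n_1,\dots,n_k$ with $\beta(f(n_1))\cap\dots\cap\beta(f(n_k))\subseteq B$. The restricted numbered subbasis of $A$: $\text{dom}(\alpha)=\text{dom}(\beta)$, $\alpha(n)=A\cap\beta(n)$, $\mathfrak{A}=\alpha(\text{dom}\,\alpha)$; $\rho_\alpha^{\min}$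 is defined on $A$ in the same way with $\alpha$, $\mathfrak{A}$ in place of $\beta$, $\mathfrak{B}$. -}

module Defs where

open import Data.Nat using (ℕ; zero; suc; _<_)
open import Data.Fin using (Fin)
open import Data.Vec using (Vec; []; _∷_; lookup)
open import Data.List using (List)
open import Data.List.Relation.Unary.All using (All)
open import Data.Product using (Σ; Σ-syntax; _×_; _,_; proj₁)

-- Type-2 computability: Kleene's oracle μ-recursive functions.
-- A code of arity n computes a partial function ℕⁿ → ℕ relative to an
-- oracle f : ℕ → ℕ (an element of Baire space).

data Code : ℕ → Set where
  zer  : ∀ {n} → Code n
  suc′ : Code 1
  prj  : ∀ {n} → Fin n → Code n
  orc  : Code 1
  comp : ∀ {m n} → Code m → Vec (Code n) m → Code n
  prec : ∀ {n} → Code n → Code (suc (suc n)) → Code (suc n)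
  mu   : ∀ {n} → Code (suc n) → Code n

mutual
  data Eval (f : ℕ → ℕ) : ∀ {n} → Code n → Vec ℕ n → ℕ → Set where
    ezer   : ∀ {n} {xs : Vec ℕ n} → Eval f zer xs 0
    esuc   : ∀ {x} → Eval f suc′ (x ∷ []) (suc x)
    eprj   : ∀ {n} {i : Fin n} {xs} → Eval f (prj i) xs (lookup xs i)
    eorc   : ∀ {x} → Eval f orc (x ∷ []) (f x)
    ecomp  : ∀ {m n} {h : Code m} {gs : Vec (Code n) m} {xs ys z} →
             EvalVec f gs xs ys → Eval f h ys z → Eval f (comp h gs) xs z
    eprec0 : ∀ {n} {g : Code n} {h : Code (suc (suc n))} {xs z} →
             Eval f g xs z → Eval f (prec g h) (0 ∷ xs) z
    eprecS : ∀ {n} {g : Code n} {h : Code (suc (suc n))} {xs k r z} →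
             Eval f (prec g h) (k ∷ xs) r → Eval f h (k ∷ r ∷ xs) z →
             Eval f (prec g h) (suc k ∷ xs) z
    emu    : ∀ {n} {g : Code (suc n)} {xs y} →
             Eval f g (y ∷ xs) 0 →
             (∀ i → i < y → Σ ℕ λ z → Eval f g (i ∷ xs) (suc z)) →
             Eval f (mu g) xs y

  data EvalVec (f : ℕ → ℕ) {n : ℕ} : ∀ {m} → Vec (Code n) m → Vec ℕ n → Vec ℕ m → Set where
    []  : ∀ {xs} → EvalVec f [] xs []
    _∷_ : ∀ {m} {g : Code n} {gs : Vec (Code n) m} {xs y ys} →
          Eval f g xs y → EvalVec f gs xs ys → EvalVec f (g ∷ gs) xs (y ∷ ys)

Computes : Code 1 → (ℕ → ℕ) → (ℕ → ℕ) → Set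
Computes e f g = ∀ n → Eval f e (n ∷ []) (g n)

MultiRep : Set → Set₁
MultiRep Y = (ℕ → ℕ) → Y → Set

Computable : {Y₁ Y₂ : Set} → MultiRep Y₁ → MultiRep Y₂ → (Y₁ → Y₂) → Set
Computable ρ₁ ρ₂ h =
  Σ[ e ∈ Code 1 ] (∀ f x → ρ₁ f x → Σ[ g ∈ (ℕ → ℕ) ] (Computes e f g × ρ₂ g (h x)))

-- Numbered subbases: a partial numbering β :⊆ ℕ → 𝔅 ⊆ P(X), given by its
-- domain and the set β n (only meaningful for n ∈ dom β); 𝔅 = β(dom β).

record NumberedSubbasis (X : Set) : Set₁ where
  field
    dom : ℕ → Set
    set : ℕ → X → Set
open NumberedSubbasis public

ρmin : {X : Set} → NumberedSubbasis X → MultiRep X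
ρmin {X} β f x =
  (∀ n → dom β (f n) × set β (f n) x) ×
  (∀ m → dom β m → set β m x →
     Σ[ ns ∈ List ℕ ] (∀ y → All (λ i → set β (f i) y) ns → set β m y))

restrict : {X : Set} → NumberedSubbasis X → (A : X → Set) → NumberedSubbasis (Σ X A)
restrict β A = record { dom = dom β ; set = λ n p → A (proj₁ p) × set β n (proj₁ p) }

{-# OPTIONS --safe #-}
-- With X = Maybe ℕ, β m = X ∖ {just m} and A = {nothing}, a name of nothing for
-- the restricted subbasis carries no information (the constant oracle 0 is one),
-- whereas a name of nothing for β must enumerate dom β. Taking dom β to be the
-- numbers 1 + ⌜e⌝ not output by the program e on oracle 0 defeats every program F
-- realising the embedding: 1 + ⌜F⌝ lies in dom β, but the output of F misses it.
module Submission where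

open import Defs
open import Data.Product using (Σ-syntax; proj₁; proj₂; _×_; _,_)
open import Relation.Nullary using (¬_)
open import Data.Nat using (ℕ; zero; suc)
open import Data.Nat.Properties using (suc-injective; <-cmp)
open import Data.Nat.Binary as Bin using (ℕᵇ; 2[1+_]; 1+[2_])
open import Data.Nat.Binary.Properties as Bin using (2[1+_]-injective)
open import Data.List using ([])
open import Data.List.Relation.Unary.All using (universal)
open import Data.Fin using (toℕ)
open import Data.Fin.Properties using (toℕ-injective)
open import Data.Vec using (Vec; []; _∷_)
open import Data.Maybe using (Maybe; just; nothing)
open import Data.Maybe.Properties using (just-injective)
open import Function using (const)
open import Relation.Binary.PropositionalEquality using (_≡_; _≢_; refl; sym; cong; cong₂)
open import Relation.Binary.Definitions using (tri<; tri≈; tri>)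

mutual
  Eval-deterministic : ∀ {f n} {e : Code n} {xs y z} → Eval f e xs y → Eval f e xs z → y ≡ z
  Eval-deterministic ezer ezer = refl
  Eval-deterministic esuc esuc = refl
  Eval-deterministic eprj eprj = refl
  Eval-deterministic eorc eorc = refl
  Eval-deterministic (ecomp gs h) (ecomp gs′ h′) with EvalVec-deterministic gs gs′
  ... | refl = Eval-deterministic h h′
  Eval-deterministic (eprec0 g) (eprec0 g′) = Eval-deterministic g g′
  Eval-deterministic (eprecS r h) (eprecS r′ h′) with Eval-deterministic r r′
  ... | refl = Eval-deterministic h h′
  Eval-deterministic (emu {y = y} zero-at-y below-y) (emu {y = y′} zero-at-y′ below-y′)
    with <-cmp y y′
  ... | tri≈ _ y≡y′ _ = y≡y′
  ... | tri< y<y′ _ _ with below-y′ y y<y′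
  ...   | _ , nonzero with Eval-deterministic zero-at-y nonzero
  ...     | ()
  Eval-deterministic (emu zero-at-y below-y) (emu {y = y′} zero-at-y′ _) | tri> _ _ y′<y
    with below-y y′ y′<y
  ...   | _ , nonzero with Eval-deterministic zero-at-y′ nonzero
  ...     | ()

  EvalVec-deterministic : ∀ {f n m} {gs : Vec (Code n) m} {xs ys zs} →
                          EvalVec f gs xs ys → EvalVec f gs xs zs → ys ≡ zs
  EvalVec-deterministic [] [] = refl
  EvalVec-deterministic (p ∷ ps) (q ∷ qs) =
    cong₂ _∷_ (Eval-deterministic p q) (EvalVec-deterministic ps qs)

unary : ℕ → ℕᵇ → ℕᵇ
unary zero    r = 1+[2 r ]
unary (suc n) r = 2[1+ unary n r ]

unary-injective : ∀ a b {r r′} → unary a r ≡ unary b r′ → a ≡ b × r ≡ r′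
unary-injective zero    zero    refl = refl , refl
unary-injective (suc a) (suc b) eq with unary-injective a b (2[1+_]-injective eq)
... | refl , r≡r′ = refl , r≡r′

-- A prefix code: the constructor is written in unary, followed by its arguments.
mutual
  serialise : ∀ {n} → Code n → ℕᵇ → ℕᵇ
  serialise zer             r = unary 0 r
  serialise suc′            r = unary 1 r
  serialise (prj i)         r = unary 2 (unary (toℕ i) r)
  serialise orc             r = unary 3 r
  serialise (comp {m} h gs) r = unary 4 (unary m (serialise h (serialiseVec gs r)))
  serialise (prec g h)      r = unary 5 (serialise g (serialise h r))
  serialise (mu g)          r = unary 6 (serialise g r)

  serialiseVec : ∀ {n m} → Vec (Code n) m → ℕᵇ → ℕᵇ
  serialiseVec []       r = r
  serialiseVec (g ∷ gs) r = serialise g (serialiseVec gs r)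

mutual
  serialise-injective : ∀ {n} (x y : Code n) {r r′} →
                        serialise x r ≡ serialise y r′ → x ≡ y × r ≡ r′
  serialise-injective zer  zer  refl = refl , refl
  serialise-injective suc′ suc′ refl = refl , refl
  serialise-injective orc  orc  refl = refl , refl
  serialise-injective (prj i) (prj j) eq
    with unary-injective (toℕ i) (toℕ j) (proj₂ (unary-injective 2 2 eq))
  ... | i≡j , r≡r′ = cong prj (toℕ-injective i≡j) , r≡r′
  serialise-injective (comp {m} h gs) (comp {m′} h′ gs′) eq
    with unary-injective m m′ (proj₂ (unary-injective 4 4 eq))
  ... | refl , eq₁ with serialise-injective h h′ eq₁
  ... | refl , eq₂ with serialiseVec-injective gs gs′ eq₂
  ... | refl , r≡r′ = refl , r≡r′
  serialise-injective (prec g h) (prec g′ h′) eq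
    with serialise-injective g g′ (proj₂ (unary-injective 5 5 eq))
  ... | refl , eq₁ with serialise-injective h h′ eq₁
  ... | refl , r≡r′ = refl , r≡r′
  serialise-injective (mu g) (mu g′) eq
    with serialise-injective g g′ (proj₂ (unary-injective 6 6 eq))
  ... | refl , r≡r′ = refl , r≡r′
  serialise-injective zer suc′ ()
  serialise-injective zer (prj _) ()
  serialise-injective zer orc ()
  serialise-injective zer (comp _ _) ()
  serialise-injective zer (prec _ _) ()
  serialise-injective zer (mu _) ()
  serialise-injective suc′ zer ()
  serialise-injective suc′ (prj _) ()
  serialise-injective suc′ orc ()
  serialise-injective suc′ (comp _ _) ()
  serialise-injective suc′ (prec _ _) ()
  serialise-injective suc′ (mu _) ()
  serialise-injective (prj _) zer ()
  serialise-injective (prj _) suc′ ()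
  serialise-injective (prj _) orc ()
  serialise-injective (prj _) (comp _ _) ()
  serialise-injective (prj _) (prec _ _) ()
  serialise-injective (prj _) (mu _) ()
  serialise-injective orc zer ()
  serialise-injective orc suc′ ()
  serialise-injective orc (prj _) ()
  serialise-injective orc (comp _ _) ()
  serialise-injective orc (prec _ _) ()
  serialise-injective orc (mu _) ()
  serialise-injective (comp _ _) zer ()
  serialise-injective (comp _ _) suc′ ()
  serialise-injective (comp _ _) (prj _) ()
  serialise-injective (comp _ _) orc ()
  serialise-injective (comp _ _) (prec _ _) ()
  serialise-injective (comp _ _) (mu _) ()
  serialise-injective (prec _ _) zer ()
  serialise-injective (prec _ _) suc′ ()
  serialise-injective (prec _ _) (prj _) ()
  serialise-injective (prec _ _) orc ()
  serialise-injective (prec _ _) (comp _ _) ()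
  serialise-injective (prec _ _) (mu _) ()
  serialise-injective (mu _) zer ()
  serialise-injective (mu _) suc′ ()
  serialise-injective (mu _) (prj _) ()
  serialise-injective (mu _) orc ()
  serialise-injective (mu _) (comp _ _) ()
  serialise-injective (mu _) (prec _ _) ()

  serialiseVec-injective : ∀ {n m} (xs ys : Vec (Code n) m) {r r′} →
                           serialiseVec xs r ≡ serialiseVec ys r′ → xs ≡ ys × r ≡ r′
  serialiseVec-injective []       []       eq = refl , eq
  serialiseVec-injective (x ∷ xs) (y ∷ ys) eq with serialise-injective x y eq
  ... | refl , eq′ with serialiseVec-injective xs ys eq′
  ... | refl , r≡r′ = refl , r≡r′

encode : ∀ {n} → Code n → ℕ
encode e = Bin.toℕ (serialise e Bin.zero)

encode-injective : ∀ {n} (e e′ : Code n) → encode e ≡ encode e′ → e ≡ e′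
encode-injective e e′ eq = proj₁ (serialise-injective e e′ (Bin.toℕ-injective eq))

pointComplements : (ℕ → Set) → NumberedSubbasis (Maybe ℕ)
pointComplements D = record { dom = D ; set = λ m y → y ≢ just m }

constant-names-nothing : ∀ {D n} → D n →
  ρmin (restrict (pointComplements D) (_≡ nothing)) (const n) (nothing , refl)
constant-names-nothing Dn =
  (λ _ → Dn , refl , λ ()) , λ _ _ _ → [] , λ { (_ , refl) _ → refl , λ () }

names-of-nothing-hit-dom : ∀ {D g m} → ρmin (pointComplements D) g nothing →
                           D m → ¬ (∀ i → g i ≢ m)
names-of-nothing-hit-dom (_ , cover) Dm misses with cover _ Dm (λ ())
... | ns , covered =
  covered _ (universal (λ i eq → misses i (sym (just-injective eq))) ns) refl

OutputsOnZero : Code 1 → ℕ → Set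
OutputsOnZero e c = Σ[ k ∈ ℕ ] Eval (const 0) e (k ∷ []) c

-- Codes are shifted by one so that 0 ∈ Diagonal, giving a value for the input oracle.
Diagonal : ℕ → Set
Diagonal c = ∀ e → c ≡ suc (encode e) → ¬ OutputsOnZero e c

Diagonal-zero : Diagonal 0
Diagonal-zero _ ()

Diagonal-not-enumerable : ∀ {e g} → Computes e (const 0) g → (∀ i → Diagonal (g i)) →
                          Σ[ c ∈ ℕ ] Diagonal c × (∀ i → g i ≢ c)
Diagonal-not-enumerable {e} {g} computes into = suc (encode e) , diagonal , missed
  where
  missed : ∀ i → g i ≢ suc (encode e)
  missed i eq = into i e eq (i , computes i)

  diagonal : Diagonal (suc (encode e))
  diagonal e′ eq (k , outputs) with encode-injective e′ e (sym (suc-injective eq))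
  ... | refl = missed k (Eval-deterministic (computes k) outputs)

proposition4p4 : Σ[ X ∈ Set ] Σ[ β ∈ NumberedSubbasis X ] Σ[ A ∈ (X → Set) ]
                   ¬ Computable (ρmin (restrict β A)) (ρmin β) (proj₁ {B = A})
proposition4p4 = Maybe ℕ , pointComplements Diagonal , (_≡ nothing) , not-computable
  where
  not-computable : ¬ Computable (ρmin (restrict (pointComplements Diagonal) (_≡ nothing)))
                                (ρmin (pointComplements Diagonal)) proj₁
  not-computable (e , realises)
    with realises (const 0) (nothing , refl) (constant-names-nothing Diagonal-zero)
  ... | g , computes , names@(in-dom , _)
    with Diagonal-not-enumerable computes (λ i → proj₁ (in-dom i))
  ... | c , c-in-Diagonal , missed = names-of-nothing-hit-dom names c-in-Diagonal missed
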